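{- Let $p,q$ be primes and $a,b$ positive integers. The equation $p^a-1=\binom{q^b}{3}$ has exactly the solutions $(p,q,a,b)=(5,2,1,2),(2,3,1,1),(11,5,1,1)$. -}

module Defs where

-- Since q^b ≥ 2 we may write q^b = m + 2, and the closed form C(m+2,3) = (m+2)(m+1)m/6
-- turns the equation into the factorisation
--     6 · p^a = (m + 3)(m² + 2).
-- Every common divisor of the two factors divides 11, because (m²+2) + 3(m+3) = m(m+3) + 11.
-- So either p misses one of the factors, which then divides 6 and m < 6; or p = 11, and
-- 11² misses one of the factors, which then divides 6·11 and m < 66.  A bound on m bounds
-- p^a and q^b, hence p, q, a and b, and the finitely many remaining quadruples are decided
-- by computation.

module Submission where

open import Defs
open import Data.Nat using (ℕ; _∸_; _^_; _≤_)
open import Data.Nat.Primality using (Prime)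
open import Data.Nat.Combinatorics using (_C_)
open import Data.Product using (_×_)
open import Data.Sum using (_⊎_)
open import Relation.Binary.PropositionalEquality using (_≡_)
open import Function.Bundles using (_⇔_)

open import Data.Nat using (zero; suc; _+_; _*_; _<_; s≤s; z≤n; _≟_; _≤?_; _<?_; NonZero; nonTrivial⇒n>1)
open import Data.Nat.Properties
open import Data.Nat.Divisibility
open import Data.Nat.Coprimality using (Coprime; coprime-divisor)
open import Data.Nat.Primality using (prime?; prime⇒irreducible; prime⇒nonTrivial; prime⇒nonZero)
open import Data.Nat.Combinatorics using (nCk+nC[k+1]≡[n+1]C[k+1]; nC1≡n)
open import Data.Nat.Tactic.RingSolver using (solve-∀)
open import Data.Product using (_,_)
open import Data.Sum using (inj₁; inj₂)
open import Data.Empty using (⊥-elim)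
open import Relation.Nullary using (¬_; Dec; yes; no)
open import Relation.Nullary.Decidable using (from-yes; _×-dec_; _⊎-dec_; _→-dec_)
open import Relation.Binary.PropositionalEquality using (refl; sym; trans; cong; subst; module ≡-Reasoning)
open import Function.Bundles using (mk⇔)

Solution : ℕ → ℕ → ℕ → ℕ → Set
Solution p q a b =
  (p ≡ 5 × q ≡ 2 × a ≡ 1 × b ≡ 2) ⊎
  (p ≡ 2 × q ≡ 3 × a ≡ 1 × b ≡ 1) ⊎
  (p ≡ 11 × q ≡ 5 × a ≡ 1 × b ≡ 1)

solution⇒equation : ∀ {p q a b} → Solution p q a b → p ^ a ∸ 1 ≡ (q ^ b) C 3
solution⇒equation (inj₁ (refl , refl , refl , refl)) = refl
solution⇒equation (inj₂ (inj₁ (refl , refl , refl , refl))) = refl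
solution⇒equation (inj₂ (inj₂ (refl , refl , refl , refl))) = refl

choose-2 : ∀ m → ((2 + m) C 2) * 2 ≡ (2 + m) * (1 + m)
choose-2 zero = refl
choose-2 (suc m) = begin
  ((3 + m) C 2) * 2                 ≡⟨ cong (_* 2) (nCk+nC[k+1]≡[n+1]C[k+1] (2 + m) 1) ⟨
  ((2 + m) C 1 + (2 + m) C 2) * 2   ≡⟨ cong (λ c → (c + (2 + m) C 2) * 2) (nC1≡n (2 + m)) ⟩
  ((2 + m) + (2 + m) C 2) * 2       ≡⟨ *-distribʳ-+ 2 (2 + m) ((2 + m) C 2) ⟩
  (2 + m) * 2 + ((2 + m) C 2) * 2   ≡⟨ cong ((2 + m) * 2 +_) (choose-2 m) ⟩
  (2 + m) * 2 + (2 + m) * (1 + m)   ≡⟨ collect m ⟩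
  (3 + m) * (2 + m)                 ∎
  where
  open ≡-Reasoning
  collect : ∀ m → (2 + m) * 2 + (2 + m) * (1 + m) ≡ (3 + m) * (2 + m)
  collect = solve-∀

choose-3 : ∀ m → ((2 + m) C 3) * 6 ≡ (2 + m) * (1 + m) * m
choose-3 zero = refl
choose-3 (suc m) = begin
  ((3 + m) C 3) * 6                             ≡⟨ cong (_* 6) (nCk+nC[k+1]≡[n+1]C[k+1] (2 + m) 2) ⟨
  ((2 + m) C 2 + (2 + m) C 3) * 6               ≡⟨ *-distribʳ-+ 6 ((2 + m) C 2) ((2 + m) C 3) ⟩
  ((2 + m) C 2) * 6 + ((2 + m) C 3) * 6         ≡⟨ cong (((2 + m) C 2) * 6 +_) (choose-3 m) ⟩
  ((2 + m) C 2) * 6 + (2 + m) * (1 + m) * m     ≡⟨ cong (_+ (2 + m) * (1 + m) * m) (*-assoc ((2 + m) C 2) 2 3) ⟨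
  ((2 + m) C 2) * 2 * 3 + (2 + m) * (1 + m) * m ≡⟨ cong (λ t → t * 3 + (2 + m) * (1 + m) * m) (choose-2 m) ⟩
  (2 + m) * (1 + m) * 3 + (2 + m) * (1 + m) * m ≡⟨ collect m ⟩
  (3 + m) * (2 + m) * (1 + m)                   ∎
  where
  open ≡-Reasoning
  collect : ∀ m → (2 + m) * (1 + m) * 3 + (2 + m) * (1 + m) * m ≡ (3 + m) * (2 + m) * (1 + m)
  collect = solve-∀

choose-3-factorisation : ∀ m → 6 * ((2 + m) C 3 + 1) ≡ (3 + m) * (2 + m * m)
choose-3-factorisation m = begin
  6 * ((2 + m) C 3 + 1)     ≡⟨ distribute ((2 + m) C 3) ⟩
  ((2 + m) C 3) * 6 + 6     ≡⟨ cong (_+ 6) (choose-3 m) ⟩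
  (2 + m) * (1 + m) * m + 6 ≡⟨ factor m ⟩
  (3 + m) * (2 + m * m)     ∎
  where
  open ≡-Reasoning
  distribute : ∀ c → 6 * (c + 1) ≡ c * 6 + 6
  distribute = solve-∀
  factor : ∀ m → (2 + m) * (1 + m) * m + 6 ≡ (3 + m) * (2 + m * m)
  factor = solve-∀

equation⇒factorisation : ∀ {x} m → 1 ≤ x → x ∸ 1 ≡ (2 + m) C 3 → 6 * x ≡ (3 + m) * (2 + m * m)
equation⇒factorisation {x} m 1≤x eq = begin
  6 * x                 ≡⟨ cong (6 *_) (m∸n+n≡m 1≤x) ⟨
  6 * (x ∸ 1 + 1)       ≡⟨ cong (λ y → 6 * (y + 1)) eq ⟩
  6 * ((2 + m) C 3 + 1) ≡⟨ choose-3-factorisation m ⟩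
  (3 + m) * (2 + m * m) ∎
  where open ≡-Reasoning

common-divisor∣11 : ∀ {d m} → d ∣ 3 + m → d ∣ 2 + m * m → d ∣ 11
common-divisor∣11 {d} {m} d∣A d∣B =
  ∣m+n∣m⇒∣n (subst (d ∣_) (identity m) (∣m∣n⇒∣m+n d∣B (∣n⇒∣m*n 3 d∣A))) (∣n⇒∣m*n m d∣A)
  where
  identity : ∀ m → (2 + m * m) + 3 * (3 + m) ≡ m * (3 + m) + 11
  identity = solve-∀

prime≥2 : ∀ {p} → Prime p → 2 ≤ p
prime≥2 {p} pp = nonTrivial⇒n>1 p {{prime⇒nonTrivial pp}}

prime∣prime⇒≡ : ∀ {p q} → Prime p → Prime q → p ∣ q → p ≡ q
prime∣prime⇒≡ pp pq p∣q with prime⇒irreducible pq p∣q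
... | inj₁ refl = ⊥-elim (<⇒≱ (prime≥2 pp) (s≤s z≤n))
... | inj₂ p≡q = p≡q

prime-11 : Prime 11
prime-11 = from-yes (prime? 11)

¬∣⇒coprime : ∀ {p x} → Prime p → ¬ p ∣ x → Coprime x p
¬∣⇒coprime pp p∤x (i∣x , i∣p) with prime⇒irreducible pp i∣p
... | inj₁ i≡1 = i≡1
... | inj₂ refl = ⊥-elim (p∤x i∣x)

cancel-prime-power : ∀ {p x} → Prime p → ¬ p ∣ x → ∀ c a → x ∣ c * p ^ a → x ∣ c
cancel-prime-power pp p∤x c zero x∣c*1 = subst (_ ∣_) (*-identityʳ c) x∣c*1
cancel-prime-power {p} {x} pp p∤x c (suc a) x∣cpᵃ⁺¹ =
  coprime-divisor (¬∣⇒coprime pp p∤x)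
    (subst (x ∣_) (*-comm c p) (cancel-prime-power pp p∤x (c * p) a
      (subst (x ∣_) (sym (*-assoc c p (p ^ a))) x∣cpᵃ⁺¹)))

cancel-prime-power′ : ∀ {p x} → Prime p → p ∣ x → ¬ p * p ∣ x → ∀ c a → x ∣ c * p ^ a → x ∣ c * p
cancel-prime-power′ {p} pp (divides k refl) p²∤x c a kp∣cpᵃ =
  *-monoˡ-∣ p (cancel-prime-power pp p∤k c a (∣-trans (m∣m*n p) kp∣cpᵃ))
  where
  p∤k : ¬ p ∣ k
  p∤k (divides j refl) = p²∤x (divides j (*-assoc j p p))

linear-factor-bound : ∀ {m c} .{{_ : NonZero c}} → 3 + m ∣ c → m < c
linear-factor-bound {m} A∣c = ≤-trans (m≤n+m (suc m) 2) (∣⇒≤ A∣c)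

quadratic-factor-bound : ∀ {m c} .{{_ : NonZero c}} → 2 + m * m ∣ c → m < c
quadratic-factor-bound {m} B∣c = ≤-trans (s≤s (m≤n⇒m≤1+n (m≤m*m m))) (∣⇒≤ B∣c)
  where
  m≤m*m : ∀ m → m ≤ m * m
  m≤m*m zero = z≤n
  m≤m*m m@(suc _) = m≤m*n m m

-- If both factors divide 6·11^a and 11 divides both, then 11² misses one of them (its square
-- would divide 11), and that factor divides 6·11.
eleven-bound : ∀ {a m} → 3 + m ∣ 6 * 11 ^ a → 2 + m * m ∣ 6 * 11 ^ a →
  11 ∣ 3 + m → 11 ∣ 2 + m * m → m < 66
eleven-bound {a} {m} A∣ B∣ 11∣A 11∣B with 11 * 11 ∣? 3 + m | 11 * 11 ∣? 2 + m * m
... | no 121∤A | _ = linear-factor-bound (cancel-prime-power′ prime-11 11∣A 121∤A 6 a A∣)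
... | yes _ | no 121∤B = quadratic-factor-bound (cancel-prime-power′ prime-11 11∣B 121∤B 6 a B∣)
... | yes 121∣A | yes 121∣B =
  ⊥-elim (<⇒≱ (from-yes (11 <? 121)) (∣⇒≤ (common-divisor∣11 121∣A 121∣B)))

factor-analysis : ∀ {p a m} → Prime p → 3 + m ∣ 6 * p ^ a → 2 + m * m ∣ 6 * p ^ a →
  m < 6 ⊎ (p ≡ 11 × m < 66)
factor-analysis {p} {a} {m} pp A∣ B∣ with p ∣? 3 + m | p ∣? 2 + m * m
... | no p∤A | _ = inj₁ (linear-factor-bound (cancel-prime-power pp p∤A 6 a A∣))
... | yes _ | no p∤B = inj₁ (quadratic-factor-bound (cancel-prime-power pp p∤B 6 a B∣))
... | yes p∣A | yes p∣B with prime∣prime⇒≡ pp prime-11 (common-divisor∣11 p∣A p∣B)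
...   | refl = inj₂ (refl , eleven-bound {a} A∣ B∣ p∣A p∣B)

power-bound : ∀ {x m M} → 6 * x ≡ (3 + m) * (2 + m * m) → m ≤ M → x ≤ (2 + M) C 3 + 1
power-bound {x} {m} {M} e m≤M = *-cancelˡ-≤ 6 (begin
  6 * x                 ≡⟨ e ⟩
  (3 + m) * (2 + m * m) ≤⟨ *-mono-≤ (+-monoʳ-≤ 3 m≤M) (+-monoʳ-≤ 2 (*-mono-≤ m≤M m≤M)) ⟩
  (3 + M) * (2 + M * M) ≡⟨ choose-3-factorisation M ⟨
  6 * ((2 + M) C 3 + 1) ∎)
  where open ≤-Reasoning

base≤power : ∀ {x k} → 1 ≤ k → x ≤ x ^ k
base≤power {zero} _ = z≤n
base≤power {x@(suc _)} {suc k} _ = m≤m*n x (x ^ k) {{m^n≢0 x k}}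

exponent-bound : ∀ {x₀ x k N K} .{{_ : NonZero x₀}} → x₀ ≤ x → x ^ k ≤ N → N < x₀ ^ K → k < K
exponent-bound {x₀} {x} {k} x₀≤x xᵏ≤N N<x₀ᴷ =
  ≰⇒> λ K≤k → <⇒≱ N<x₀ᴷ (≤-trans (^-monoʳ-≤ x₀ K≤k) (≤-trans (^-monoˡ-≤ k x₀≤x) xᵏ≤N))

Claim : ℕ → ℕ → ℕ → ℕ → Set
Claim p q a b = p ^ a ∸ 1 ≡ (q ^ b) C 3 → Prime p → Prime q → 1 ≤ a → 1 ≤ b → Solution p q a b

Box : ℕ → ℕ → ℕ → ℕ → Set
Box p A Q B = ∀ {a} → a < A → ∀ {q} → q < Q → ∀ {b} → b < B → Claim p q a b

box? : ∀ p A Q B → Dec (Box p A Q B)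
box? p A Q B = allUpTo? (λ a → allUpTo? (λ q → allUpTo? (λ b → claim? q a b) B) Q) A
  where
  solution? : ∀ q a b → Dec (Solution p q a b)
  solution? q a b =
    (p ≟ 5 ×-dec q ≟ 2 ×-dec a ≟ 1 ×-dec b ≟ 2) ⊎-dec
    (p ≟ 2 ×-dec q ≟ 3 ×-dec a ≟ 1 ×-dec b ≟ 1) ⊎-dec
    (p ≟ 11 ×-dec q ≟ 5 ×-dec a ≟ 1 ×-dec b ≟ 1)
  claim? : ∀ q a b → Dec (Claim p q a b)
  claim? q a b = (p ^ a ∸ 1 ≟ (q ^ b) C 3) →-dec (prime? p →-dec (prime? q →-dec
    (1 ≤? a →-dec (1 ≤? b →-dec solution? q a b))))

-- The two finite searches: m ≤ 5 gives p^a ≤ 36 and q^b ≤ 7; p = 11, m ≤ 65 gives q^b ≤ 67.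
small-search : ∀ {p} → p < 37 → Box p 6 8 3
small-search = from-yes (allUpTo? (λ p → box? p 6 8 3) 37)

eleven-search : Box 11 5 68 7
eleven-search = from-yes (box? 11 5 68 7)

factorised⇒solution : ∀ {p q a b m} → Prime p → Prime q → 1 ≤ a → 1 ≤ b →
  p ^ a ∸ 1 ≡ (q ^ b) C 3 → q ^ b ≡ 2 + m → 6 * p ^ a ≡ (3 + m) * (2 + m * m) → Solution p q a b
factorised⇒solution {p} {q} {a} {b} {m} pp pq 1≤a 1≤b eq qᵇ≡2+m e
  with factor-analysis {a = a} pp (subst (3 + m ∣_) (sym e) (m∣m*n (2 + m * m)))
                                   (subst (2 + m * m ∣_) (sym e) (n∣m*n (3 + m)))
... | inj₁ m<6 = small-search p<37 a<6 q<8 b<3 eq pp pq 1≤a 1≤b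
  where
  m≤5 : m ≤ 5
  m≤5 = ≤-pred m<6
  pᵃ≤36 : p ^ a ≤ 36
  pᵃ≤36 = power-bound e m≤5
  qᵇ≤7 : q ^ b ≤ 7
  qᵇ≤7 = subst (_≤ 7) (sym qᵇ≡2+m) (+-monoʳ-≤ 2 m≤5)
  p<37 : p < 37
  p<37 = s≤s (≤-trans (base≤power 1≤a) pᵃ≤36)
  a<6 : a < 6
  a<6 = exponent-bound (prime≥2 pp) pᵃ≤36 (from-yes (36 <? 2 ^ 6))
  q<8 : q < 8
  q<8 = s≤s (≤-trans (base≤power 1≤b) qᵇ≤7)
  b<3 : b < 3
  b<3 = exponent-bound (prime≥2 pq) qᵇ≤7 (from-yes (7 <? 2 ^ 3))
... | inj₂ (refl , m<66) = eleven-search a<5 q<68 b<7 eq pp pq 1≤a 1≤b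
  where
  m≤65 : m ≤ 65
  m≤65 = ≤-pred m<66
  11ᵃ≤47906 : 11 ^ a ≤ 47906
  11ᵃ≤47906 = power-bound e m≤65
  qᵇ≤67 : q ^ b ≤ 67
  qᵇ≤67 = subst (_≤ 67) (sym qᵇ≡2+m) (+-monoʳ-≤ 2 m≤65)
  a<5 : a < 5
  a<5 = exponent-bound ≤-refl 11ᵃ≤47906 (from-yes (47906 <? 11 ^ 5))
  q<68 : q < 68
  q<68 = s≤s (≤-trans (base≤power 1≤b) qᵇ≤67)
  b<7 : b < 7
  b<7 = exponent-bound (prime≥2 pq) qᵇ≤67 (from-yes (67 <? 2 ^ 7))

equation⇒solution : ∀ {p q a b} → Prime p → Prime q → 1 ≤ a → 1 ≤ b →
  p ^ a ∸ 1 ≡ (q ^ b) C 3 → Solution p q a b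
equation⇒solution {p} {q} {a} {b} pp pq 1≤a 1≤b eq =
  factorised⇒solution pp pq 1≤a 1≤b eq qᵇ≡2+m
    (equation⇒factorisation m (m^n>0 p {{prime⇒nonZero pp}} a) (trans eq (cong (_C 3) qᵇ≡2+m)))
  where
  m : ℕ
  m = q ^ b ∸ 2
  qᵇ≡2+m : q ^ b ≡ 2 + m
  qᵇ≡2+m = sym (m+[n∸m]≡n (≤-trans (prime≥2 pq) (base≤power 1≤b)))

mainTheorem2 : (p q a b : ℕ) → Prime p → Prime q → 1 ≤ a → 1 ≤ b →
    ((p ^ a ∸ 1 ≡ (q ^ b) C 3) ⇔
    ((p ≡ 5 × q ≡ 2 × a ≡ 1 × b ≡ 2) ⊎
    (p ≡ 2 × q ≡ 3 × a ≡ 1 × b ≡ 1) ⊎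
    (p ≡ 11 × q ≡ 5 × a ≡ 1 × b ≡ 1)))
mainTheorem2 p q a b pp pq 1≤a 1≤b =
  mk⇔ (equation⇒solution pp pq 1≤a 1≤b) solution⇒equation
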